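{- Let $P=F_1\cdots F_k$ be a Schröder path factored into its $k$ factors. For $1\le i\le k$ let $f_i$ be the number of $U$ steps of $F_i$ (which equals its number of $D$ steps) and let $h_i$ be the number of $H_2$ steps of $F_i$. Let $\ell$ be the word length of $P$. Then the number of Schröder paths covering $P$ in the Schröder pattern poset is $$2+\ell+\sum_{1\le i\le j\le k}(f_i+h_i)(f_j+h_j).$$
   Context: Schröder paths and the pattern order: - A Schröder path is a finite word over $\{U,D,H_2\}$, interpreted as a lattice path from $(0,0)$ with steps $U=(1,1)$, $D=(1,-1)$, $H_2=(2,0)$. - It ends on the $x$-axis and never goes below it; the empty word is allowed. - Its semilength is (number of $U$'s) + (number of $H_2$'s). - Its word length is the number of letters of the word. - $P\le Q$ means $P$ occurs as a (not necessarily contiguous) subword of $Q$. - $Q$ covers $P$ means $P\le Q$ and $\mathrm{semilength}(P)=\mathrm{semilength}(Q)-1$. Factors: Let $p_0=(0,0),\dots,p_k$ be the successive vertices of $P$ (endpoints of prefixes) on the $x$-axis. The factor $F_i$ is the subpath from $p_{i-1}$ to $p_i$; each factor is either $H_2$ or of the form $URD$ with $R$ a Schröder path. -}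

module Defs where

open import Data.Nat using (ℕ; zero; suc; _+_; _*_)
open import Data.List using (List; []; _∷_; _++_; [_])
open import Data.Nat.ListAction using (sum)

-- Steps: U = (1,1), D = (1,-1), H2 = (2,0)
data Step : Set where
  U D H2 : Step

data SchröderFrom : ℕ → List Step → Set where
  done : SchröderFrom 0 []
  up   : ∀ {h w} → SchröderFrom (suc h) w → SchröderFrom h (U ∷ w)
  down : ∀ {h w} → SchröderFrom h w → SchröderFrom (suc h) (D ∷ w)
  hor  : ∀ {h w} → SchröderFrom h w → SchröderFrom h (H2 ∷ w)

SchröderPath : List Step → Set
SchröderPath w = SchröderFrom 0 w

#U : List Step → ℕ
#U [] = 0
#U (U ∷ w) = suc (#U w)
#U (D ∷ w) = #U w
#U (H2 ∷ w) = #U w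

#H : List Step → ℕ
#H [] = 0
#H (H2 ∷ w) = suc (#H w)
#H (U ∷ w) = #H w
#H (D ∷ w) = #H w

semilength : List Step → ℕ
semilength w = #U w + #H w

data IsFactor : List Step → Set where
  hfac : IsFactor [ H2 ]
  ufac : ∀ {R} → SchröderPath R → IsFactor (U ∷ (R ++ [ D ]))

data Factorisation : List Step → List (List Step) → Set where
  []  : Factorisation [] []
  _∷_ : ∀ {F P Fs} → IsFactor F → Factorisation P Fs → Factorisation (F ++ P) (F ∷ Fs)

pairSum : List ℕ → ℕ
pairSum [] = 0
pairSum (a ∷ as) = a * (a + sum as) + pairSum as

-- A path Q covers P exactly when Q is a Schröder path obtained from P by inserting either
-- one H2 or one U and one D: P and Q both return to the x-axis, so a superword has as many
-- extra D's as extra U's. Candidate words are enumerated through the leftmost embedding of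
-- P, so that each appears once, and one counts those that stay above the x-axis by reading
-- them from the left while tracking the height. An inserted H2 is always admissible, which
-- gives 1 + #U P + #D P coverers. For an inserted U and D, a factor H2 contributes
-- 2 + t coverers and a factor U R D contributes #H R + (1 + s)(1 + s + t), where s is the
-- semilength of R and t that of the part of P after the factor; with the single coverer UD
-- of the empty path this adds up to 1 + #H P + Σ_{i≤j} (f_i + h_i)(f_j + h_j).

module Submission where

open import Defs
open import Data.Bool using (true; false)
open import Data.List using (List; []; _∷_; _++_; [_]; length; map; filter)
open import Data.List.Membership.Propositional using (_∈_)
open import Data.List.Membership.Propositional.Properties
  using (∈-map⁺; ∈-map⁻; ∈-++⁺ˡ; ∈-++⁺ʳ; ∈-++⁻; ∈-filter⁺; ∈-filter⁻)
open import Data.List.Properties using (∷-injectiveˡ; ∷-injectiveʳ; length-++; filter-++; filter-accept)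
open import Data.List.Relation.Binary.Disjoint.Propositional using (Disjoint)
open import Data.List.Relation.Binary.Sublist.Heterogeneous.Properties using (∷⁻)
open import Data.List.Relation.Binary.Sublist.Propositional using (_⊆_; []; _∷_; _∷ʳ_)
import Data.List.Relation.Unary.All as All
open import Data.List.Relation.Unary.AllPairs using ([]; _∷_)
open import Data.List.Relation.Unary.Any using (here)
open import Data.List.Relation.Unary.Unique.Propositional using (Unique)
import Data.List.Relation.Unary.Unique.Propositional.Properties as Unique
open import Data.Nat using (ℕ; zero; suc; 2+; _+_; _*_; _≤_; z≤n; s≤s)
open import Data.Nat.ListAction using (sum)
open import Data.Nat.Properties
  using (+-comm; +-suc; +-identityʳ; +-cancelˡ-≡; +-commutativeSemigroup; suc-injective; m≤n⇒m≤1+n; 1+n≰n; m≤n⇒∃[o]m+o≡n)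
open import Data.Nat.Tactic.RingSolver using (solve-∀)
open import Algebra.Properties.CommutativeSemigroup +-commutativeSemigroup using (interchange)
open import Data.Product using (Σ; Σ-syntax; _×_; _,_)
open import Data.Sum using (_⊎_; inj₁; inj₂)
open import Function.Bundles using (_⇔_; mk⇔)
open import Relation.Binary.PropositionalEquality
  using (_≡_; _≢_; refl; sym; trans; cong; cong₂; subst; module ≡-Reasoning)
open import Relation.Nullary using (yes; no; does; map′; contradiction)
open import Relation.Unary using (Pred; Decidable)
open ≡-Reasoning

private variable
  k u h d : ℕ
  w Q P : List Step

#D : List Step → ℕ
#D []       = 0
#D (D ∷ w)  = suc (#D w)
#D (U ∷ w)  = #D w
#D (H2 ∷ w) = #D w

#U-++ : ∀ v w → #U (v ++ w) ≡ #U v + #U w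
#U-++ []       w = refl
#U-++ (U ∷ v)  w = cong suc (#U-++ v w)
#U-++ (D ∷ v)  w = #U-++ v w
#U-++ (H2 ∷ v) w = #U-++ v w

#H-++ : ∀ v w → #H (v ++ w) ≡ #H v + #H w
#H-++ []       w = refl
#H-++ (U ∷ v)  w = #H-++ v w
#H-++ (D ∷ v)  w = #H-++ v w
#H-++ (H2 ∷ v) w = cong suc (#H-++ v w)

semilength-++ : ∀ v w → semilength (v ++ w) ≡ semilength v + semilength w
semilength-++ v w = trans (cong₂ _+_ (#U-++ v w) (#H-++ v w)) (interchange (#U v) (#U w) (#H v) (#H w))

semilength-H2∷ : ∀ w → semilength (H2 ∷ w) ≡ suc (semilength w)
semilength-H2∷ w = +-suc (#U w) (#H w)

length≡#U+#D+#H : ∀ w → length w ≡ #U w + #D w + #H w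
length≡#U+#D+#H []       = refl
length≡#U+#D+#H (U ∷ w)  = cong suc (length≡#U+#D+#H w)
length≡#U+#D+#H (D ∷ w)  = trans (cong suc (length≡#U+#D+#H w)) (cong (_+ #H w) (sym (+-suc (#U w) (#D w))))
length≡#U+#D+#H (H2 ∷ w) = trans (cong suc (length≡#U+#D+#H w)) (sym (+-suc (#U w + #D w) (#H w)))

#U-mono : w ⊆ Q → #U w ≤ #U Q
#U-mono []                    = z≤n
#U-mono (U  ∷ʳ s)             = m≤n⇒m≤1+n (#U-mono s)
#U-mono (D  ∷ʳ s)             = #U-mono s
#U-mono (H2 ∷ʳ s)             = #U-mono s
#U-mono (_∷_ {x = U}  refl s) = s≤s (#U-mono s)
#U-mono (_∷_ {x = D}  refl s) = #U-mono s
#U-mono (_∷_ {x = H2} refl s) = #U-mono s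

#H-mono : w ⊆ Q → #H w ≤ #H Q
#H-mono []                    = z≤n
#H-mono (U  ∷ʳ s)             = #H-mono s
#H-mono (D  ∷ʳ s)             = #H-mono s
#H-mono (H2 ∷ʳ s)             = m≤n⇒m≤1+n (#H-mono s)
#H-mono (_∷_ {x = U}  refl s) = #H-mono s
#H-mono (_∷_ {x = D}  refl s) = #H-mono s
#H-mono (_∷_ {x = H2} refl s) = s≤s (#H-mono s)

#D-mono : w ⊆ Q → #D w ≤ #D Q
#D-mono []                    = z≤n
#D-mono (U  ∷ʳ s)             = #D-mono s
#D-mono (D  ∷ʳ s)             = m≤n⇒m≤1+n (#D-mono s)
#D-mono (H2 ∷ʳ s)             = #D-mono s
#D-mono (_∷_ {x = U}  refl s) = #D-mono s
#D-mono (_∷_ {x = D}  refl s) = s≤s (#D-mono s)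
#D-mono (_∷_ {x = H2} refl s) = #D-mono s

extra-positive : ∀ {m n e} → m ≤ n → suc n ≡ m + e → Σ[ e′ ∈ ℕ ] e ≡ suc e′ × n ≡ m + e′
extra-positive {m} {n} {zero} m≤n eq =
  contradiction (subst (_≤ n) (trans (sym (+-identityʳ m)) (sym eq)) m≤n) 1+n≰n
extra-positive {m} {e = suc e} _ eq = e , refl , suc-injective (trans eq (+-suc m e))

-- The U and H2 clauses come first, so that the decision computes on a word with known first
-- letter even when the height is unknown.
schröderFrom? : ∀ k → Decidable (SchröderFrom k)
schröderFrom? k       (U ∷ w)  = map′ up (λ { (up s) → s }) (schröderFrom? (suc k) w)
schröderFrom? k       (H2 ∷ w) = map′ hor (λ { (hor s) → s }) (schröderFrom? k w)
schröderFrom? zero    []       = yes done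
schröderFrom? (suc k) []       = no λ ()
schröderFrom? zero    (D ∷ w)  = no λ ()
schröderFrom? (suc k) (D ∷ w)  = map′ down (λ { (down s) → s }) (schröderFrom? k w)

SchröderFrom-balance : SchröderFrom k w → k + #U w ≡ #D w
SchröderFrom-balance done               = refl
SchröderFrom-balance {k} (up {w = w} s) = trans (+-suc k (#U w)) (SchröderFrom-balance s)
SchröderFrom-balance (down s)           = cong suc (SchröderFrom-balance s)
SchröderFrom-balance (hor s)            = SchröderFrom-balance s

data FirstPassage : ℕ → List Step → Set where
  last : FirstPassage 1 [ D ]
  up   : ∀ {k w} → FirstPassage (suc (suc k)) w → FirstPassage (suc k) (U ∷ w)
  down : ∀ {k w} → FirstPassage (suc k) w → FirstPassage (suc (suc k)) (D ∷ w)
  hor  : ∀ {k w} → FirstPassage (suc k) w → FirstPassage (suc k) (H2 ∷ w)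

FirstPassage-++ : FirstPassage k w → SchröderPath P → SchröderFrom k (w ++ P)
FirstPassage-++ last     p = down p
FirstPassage-++ (up f)   p = up (FirstPassage-++ f p)
FirstPassage-++ (down f) p = down (FirstPassage-++ f p)
FirstPassage-++ (hor f)  p = hor (FirstPassage-++ f p)

SchröderFrom-∷ʳD : SchröderFrom k w → FirstPassage (suc k) (w ++ [ D ])
SchröderFrom-∷ʳD done     = last
SchröderFrom-∷ʳD (up s)   = up (SchröderFrom-∷ʳD s)
SchröderFrom-∷ʳD (down s) = down (SchröderFrom-∷ʳD s)
SchröderFrom-∷ʳD (hor s)  = hor (SchröderFrom-∷ʳD s)

Factorisation⇒SchröderPath : ∀ {Fs} → Factorisation P Fs → SchröderPath P
Factorisation⇒SchröderPath []            = done
Factorisation⇒SchröderPath (hfac ∷ fs)   = hor (Factorisation⇒SchröderPath fs)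
Factorisation⇒SchröderPath (ufac r ∷ fs) =
  up (FirstPassage-++ (SchröderFrom-∷ʳD r) (Factorisation⇒SchröderPath fs))

sum-semilengths : ∀ {Fs} → Factorisation P Fs → sum (map semilength Fs) ≡ semilength P
sum-semilengths []                         = refl
sum-semilengths (_∷_ {F = F} {P = P} _ fs) =
  trans (cong (semilength F +_) (sum-semilengths fs)) (sym (semilength-++ F P))

-- Superwords

record Superword (u h d : ℕ) (w Q : List Step) : Set where
  constructor superword
  field
    sublist : w ⊆ Q
    extraU  : #U Q ≡ #U w + u
    extraH  : #H Q ≡ #H w + h
    extraD  : #D Q ≡ #D w + d

Superword-∷ : ∀ x → Superword u h d w Q → Superword u h d (x ∷ w) (x ∷ Q)
Superword-∷ U  (superword s a b c) = superword (refl ∷ s) (cong suc a) b c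
Superword-∷ D  (superword s a b c) = superword (refl ∷ s) a b (cong suc c)
Superword-∷ H2 (superword s a b c) = superword (refl ∷ s) a (cong suc b) c

Superword-∷⁻ : ∀ x → Superword u h d (x ∷ w) (x ∷ Q) → Superword u h d w Q
Superword-∷⁻ U  (superword s a b c) = superword (∷⁻ s) (suc-injective a) b c
Superword-∷⁻ D  (superword s a b c) = superword (∷⁻ s) a b (suc-injective c)
Superword-∷⁻ H2 (superword s a b c) = superword (∷⁻ s) a (suc-injective b) c

Superword-insertU : Superword u h d w Q → Superword (suc u) h d w (U ∷ Q)
Superword-insertU {u} {w = w} (superword s a b c) =
  superword (U ∷ʳ s) (trans (cong suc a) (sym (+-suc (#U w) u))) b c

Superword-insertH : Superword u h d w Q → Superword u (suc h) d w (H2 ∷ Q)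
Superword-insertH {h = h} {w = w} (superword s a b c) =
  superword (H2 ∷ʳ s) a (trans (cong suc b) (sym (+-suc (#H w) h))) c

Superword-insertD : Superword u h d w Q → Superword u h (suc d) w (D ∷ Q)
Superword-insertD {d = d} {w = w} (superword s a b c) =
  superword (D ∷ʳ s) a b (trans (cong suc c) (sym (+-suc (#D w) d)))

Superword-semilength : Superword u h d w Q → semilength Q ≡ semilength w + (u + h)
Superword-semilength {u} {h} {w = w} (superword _ a b _) =
  trans (cong₂ _+_ a b) (interchange (#U w) u (#H w) h)

Schröder-⊆⇒Superword : SchröderPath P → SchröderPath Q → P ⊆ Q →
  Σ[ x ∈ ℕ ] Σ[ y ∈ ℕ ] Superword x y x P Q
Schröder-⊆⇒Superword {P} {Q} p q s
  with x , a ← m≤n⇒∃[o]m+o≡n (#U-mono s) | y , b ← m≤n⇒∃[o]m+o≡n (#H-mono s) =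
  x , y , superword s (sym a) (sym b) extraD
  where
  extraD : #D Q ≡ #D P + x
  extraD = trans (sym (SchröderFrom-balance q)) (trans (sym a) (cong (_+ x) (SchröderFrom-balance p)))

ended : ℕ → ℕ → ℕ → List Step → List (List Step)
ended zero    zero    zero    []      = [ [] ]
ended zero    zero    zero    (_ ∷ _) = []
ended zero    zero    (suc _) _       = []
ended zero    (suc _) _       _       = []
ended (suc _) _       _       _       = []

-- Q is read letter by letter; a letter is matched with the next letter of w whenever they agree
-- (afterX on X ∷ w) and is an extra letter otherwise (insertX). Thus w is embedded leftmost in
-- Q, and each word with u, h and d extra letters U, H2 and D is listed exactly once.
mutual
  superwords : ℕ → ℕ → ℕ → List Step → List (List Step)
  superwords u h d w = ended u h d w ++ startingWithLetter u h d w

  startingWithLetter : ℕ → ℕ → ℕ → List Step → List (List Step)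
  startingWithLetter u h d w =
    map (U ∷_) (afterU u h d w) ++ (map (H2 ∷_) (afterH u h d w) ++ map (D ∷_) (afterD u h d w))

  afterU : ℕ → ℕ → ℕ → List Step → List (List Step)
  afterU u h d []       = insertU u h d []
  afterU u h d (U ∷ w)  = superwords u h d w
  afterU u h d (D ∷ w)  = insertU u h d (D ∷ w)
  afterU u h d (H2 ∷ w) = insertU u h d (H2 ∷ w)

  afterH : ℕ → ℕ → ℕ → List Step → List (List Step)
  afterH u h d []       = insertH u h d []
  afterH u h d (U ∷ w)  = insertH u h d (U ∷ w)
  afterH u h d (D ∷ w)  = insertH u h d (D ∷ w)
  afterH u h d (H2 ∷ w) = superwords u h d w

  afterD : ℕ → ℕ → ℕ → List Step → List (List Step)
  afterD u h d []       = insertD u h d []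
  afterD u h d (U ∷ w)  = insertD u h d (U ∷ w)
  afterD u h d (D ∷ w)  = superwords u h d w
  afterD u h d (H2 ∷ w) = insertD u h d (H2 ∷ w)

  insertU : ℕ → ℕ → ℕ → List Step → List (List Step)
  insertU zero    h d w = []
  insertU (suc u) h d w = superwords u h d w

  insertH : ℕ → ℕ → ℕ → List Step → List (List Step)
  insertH u zero    d w = []
  insertH u (suc h) d w = superwords u h d w

  insertD : ℕ → ℕ → ℕ → List Step → List (List Step)
  insertD u h zero    w = []
  insertD u h (suc d) w = superwords u h d w

∈-ended⁻ : Q ∈ ended u h d w → Superword u h d w Q
∈-ended⁻ {u = zero} {zero} {zero} {[]} (here refl) = superword [] refl refl refl

ended-unique : ∀ u h d w → Unique (ended u h d w)
ended-unique zero    zero    zero    []      = All.[] ∷ []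
ended-unique zero    zero    zero    (_ ∷ _) = []
ended-unique zero    zero    (suc _) _       = []
ended-unique zero    (suc _) _       _       = []
ended-unique (suc _) _       _       _       = []

mutual
  ∈-superwords⁻ : Q ∈ superwords u h d w → Superword u h d w Q
  ∈-superwords⁻ {u = u} {h} {d} {w} m with ∈-++⁻ (ended u h d w) m
  ... | inj₁ m′ = ∈-ended⁻ m′
  ... | inj₂ m′ = ∈-startingWithLetter⁻ m′

  ∈-startingWithLetter⁻ : Q ∈ startingWithLetter u h d w → Superword u h d w Q
  ∈-startingWithLetter⁻ {u = u} {h} {d} {w} m with ∈-++⁻ (map (U ∷_) (afterU u h d w)) m
  ... | inj₁ mU with _ , m′ , refl ← ∈-map⁻ (U ∷_) mU = ∈-afterU⁻ m′
  ... | inj₂ m₁ with ∈-++⁻ (map (H2 ∷_) (afterH u h d w)) m₁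
  ...   | inj₁ mH with _ , m′ , refl ← ∈-map⁻ (H2 ∷_) mH = ∈-afterH⁻ m′
  ...   | inj₂ mD with _ , m′ , refl ← ∈-map⁻ (D ∷_) mD = ∈-afterD⁻ m′

  ∈-afterU⁻ : Q ∈ afterU u h d w → Superword u h d w (U ∷ Q)
  ∈-afterU⁻ {w = []}     m = ∈-insertU⁻ m
  ∈-afterU⁻ {w = U ∷ _}  m = Superword-∷ U (∈-superwords⁻ m)
  ∈-afterU⁻ {w = D ∷ _}  m = ∈-insertU⁻ m
  ∈-afterU⁻ {w = H2 ∷ _} m = ∈-insertU⁻ m

  ∈-afterH⁻ : Q ∈ afterH u h d w → Superword u h d w (H2 ∷ Q)
  ∈-afterH⁻ {w = []}     m = ∈-insertH⁻ m
  ∈-afterH⁻ {w = U ∷ _}  m = ∈-insertH⁻ m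
  ∈-afterH⁻ {w = D ∷ _}  m = ∈-insertH⁻ m
  ∈-afterH⁻ {w = H2 ∷ _} m = Superword-∷ H2 (∈-superwords⁻ m)

  ∈-afterD⁻ : Q ∈ afterD u h d w → Superword u h d w (D ∷ Q)
  ∈-afterD⁻ {w = []}     m = ∈-insertD⁻ m
  ∈-afterD⁻ {w = U ∷ _}  m = ∈-insertD⁻ m
  ∈-afterD⁻ {w = D ∷ _}  m = Superword-∷ D (∈-superwords⁻ m)
  ∈-afterD⁻ {w = H2 ∷ _} m = ∈-insertD⁻ m

  ∈-insertU⁻ : Q ∈ insertU u h d w → Superword u h d w (U ∷ Q)
  ∈-insertU⁻ {u = suc _} m = Superword-insertU (∈-superwords⁻ m)

  ∈-insertH⁻ : Q ∈ insertH u h d w → Superword u h d w (H2 ∷ Q)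
  ∈-insertH⁻ {h = suc _} m = Superword-insertH (∈-superwords⁻ m)

  ∈-insertD⁻ : Q ∈ insertD u h d w → Superword u h d w (D ∷ Q)
  ∈-insertD⁻ {d = suc _} m = Superword-insertD (∈-superwords⁻ m)

∈-U-block : ∀ u h d w → Q ∈ afterU u h d w → U ∷ Q ∈ superwords u h d w
∈-U-block u h d w m = ∈-++⁺ʳ (ended u h d w) (∈-++⁺ˡ (∈-map⁺ (U ∷_) m))

∈-H-block : ∀ u h d w → Q ∈ afterH u h d w → H2 ∷ Q ∈ superwords u h d w
∈-H-block u h d w m =
  ∈-++⁺ʳ (ended u h d w) (∈-++⁺ʳ (map (U ∷_) (afterU u h d w)) (∈-++⁺ˡ (∈-map⁺ (H2 ∷_) m)))

∈-D-block : ∀ u h d w → Q ∈ afterD u h d w → D ∷ Q ∈ superwords u h d w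
∈-D-block u h d w m =
  ∈-++⁺ʳ (ended u h d w) (∈-++⁺ʳ (map (U ∷_) (afterU u h d w))
    (∈-++⁺ʳ (map (H2 ∷_) (afterH u h d w)) (∈-map⁺ (D ∷_) m)))

mutual
  ∈-superwords⁺ : Superword u h d w Q → Q ∈ superwords u h d w
  ∈-superwords⁺ {Q = []}     (superword [] refl refl refl) = here refl
  ∈-superwords⁺ {u} {h} {d} {w} {U ∷ _}  sw = ∈-U-block u h d w (∈-afterU⁺ sw)
  ∈-superwords⁺ {u} {h} {d} {w} {H2 ∷ _} sw = ∈-H-block u h d w (∈-afterH⁺ sw)
  ∈-superwords⁺ {u} {h} {d} {w} {D ∷ _}  sw = ∈-D-block u h d w (∈-afterD⁺ sw)

  ∈-afterU⁺ : Superword u h d w (U ∷ Q) → Q ∈ afterU u h d w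
  ∈-afterU⁺ {w = []}     sw@(superword (_ ∷ʳ s) _ _ _) = ∈-insertU⁺ s sw
  ∈-afterU⁺ {w = U ∷ _}  sw                            = ∈-superwords⁺ (Superword-∷⁻ U sw)
  ∈-afterU⁺ {w = D ∷ _}  sw@(superword (_ ∷ʳ s) _ _ _) = ∈-insertU⁺ s sw
  ∈-afterU⁺ {w = D ∷ _}  (superword (() ∷ _) _ _ _)
  ∈-afterU⁺ {w = H2 ∷ _} sw@(superword (_ ∷ʳ s) _ _ _) = ∈-insertU⁺ s sw
  ∈-afterU⁺ {w = H2 ∷ _} (superword (() ∷ _) _ _ _)

  ∈-afterH⁺ : Superword u h d w (H2 ∷ Q) → Q ∈ afterH u h d w
  ∈-afterH⁺ {w = []}     sw@(superword (_ ∷ʳ s) _ _ _) = ∈-insertH⁺ s sw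
  ∈-afterH⁺ {w = U ∷ _}  sw@(superword (_ ∷ʳ s) _ _ _) = ∈-insertH⁺ s sw
  ∈-afterH⁺ {w = U ∷ _}  (superword (() ∷ _) _ _ _)
  ∈-afterH⁺ {w = D ∷ _}  sw@(superword (_ ∷ʳ s) _ _ _) = ∈-insertH⁺ s sw
  ∈-afterH⁺ {w = D ∷ _}  (superword (() ∷ _) _ _ _)
  ∈-afterH⁺ {w = H2 ∷ _} sw                            = ∈-superwords⁺ (Superword-∷⁻ H2 sw)

  ∈-afterD⁺ : Superword u h d w (D ∷ Q) → Q ∈ afterD u h d w
  ∈-afterD⁺ {w = []}     sw@(superword (_ ∷ʳ s) _ _ _) = ∈-insertD⁺ s sw
  ∈-afterD⁺ {w = U ∷ _}  sw@(superword (_ ∷ʳ s) _ _ _) = ∈-insertD⁺ s sw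
  ∈-afterD⁺ {w = U ∷ _}  (superword (() ∷ _) _ _ _)
  ∈-afterD⁺ {w = D ∷ _}  sw                            = ∈-superwords⁺ (Superword-∷⁻ D sw)
  ∈-afterD⁺ {w = H2 ∷ _} sw@(superword (_ ∷ʳ s) _ _ _) = ∈-insertD⁺ s sw
  ∈-afterD⁺ {w = H2 ∷ _} (superword (() ∷ _) _ _ _)

  ∈-insertU⁺ : w ⊆ Q → Superword u h d w (U ∷ Q) → Q ∈ insertU u h d w
  ∈-insertU⁺ s (superword _ a b c) with extra-positive (#U-mono s) a
  ... | _ , refl , a′ = ∈-superwords⁺ (superword s a′ b c)

  ∈-insertH⁺ : w ⊆ Q → Superword u h d w (H2 ∷ Q) → Q ∈ insertH u h d w
  ∈-insertH⁺ s (superword _ a b c) with extra-positive (#H-mono s) b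
  ... | _ , refl , b′ = ∈-superwords⁺ (superword s a b′ c)

  ∈-insertD⁺ : w ⊆ Q → Superword u h d w (D ∷ Q) → Q ∈ insertD u h d w
  ∈-insertD⁺ s (superword _ a b c) with extra-positive (#D-mono s) c
  ... | _ , refl , c′ = ∈-superwords⁺ (superword s a b c′)

map-∷-disjoint : ∀ {A : Set} {x y : A} {L M : List (List A)} →
  x ≢ y → Disjoint (map (x ∷_) L) (map (y ∷_) M)
map-∷-disjoint x≢y (m₁ , m₂) with ∈-map⁻ _ m₁ | ∈-map⁻ _ m₂
... | _ , _ , refl | _ , _ , eq = x≢y (∷-injectiveˡ eq)

disjoint-++ʳ : ∀ {A : Set} {xs ys zs : List A} → Disjoint xs ys → Disjoint xs zs → Disjoint xs (ys ++ zs)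
disjoint-++ʳ {ys = ys} xs#ys xs#zs (m₁ , m₂) with ∈-++⁻ ys m₂
... | inj₁ m = xs#ys (m₁ , m)
... | inj₂ m = xs#zs (m₁ , m)

ended-disjoint : ∀ u h d w → Disjoint (ended u h d w) (startingWithLetter u h d w)
ended-disjoint zero    zero    zero    []      (_ , ())
ended-disjoint zero    zero    zero    (_ ∷ _) (() , _)
ended-disjoint zero    zero    (suc _) _       (() , _)
ended-disjoint zero    (suc _) _       _       (() , _)
ended-disjoint (suc _) _       _       _       (() , _)

mutual
  superwords-unique : ∀ u h d w → Unique (superwords u h d w)
  superwords-unique u h d w = Unique.++⁺ (ended-unique u h d w)
    (Unique.++⁺ (∷-unique (afterU-unique u h d w))
      (Unique.++⁺ (∷-unique (afterH-unique u h d w)) (∷-unique (afterD-unique u h d w)) (map-∷-disjoint λ ()))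
      (disjoint-++ʳ {ys = map (H2 ∷_) (afterH u h d w)} (map-∷-disjoint λ ()) (map-∷-disjoint λ ())))
    (ended-disjoint u h d w)
    where ∷-unique : ∀ {x} {L} → Unique L → Unique (map (x ∷_) L)
          ∷-unique = Unique.map⁺ ∷-injectiveʳ

  afterU-unique : ∀ u h d w → Unique (afterU u h d w)
  afterU-unique u h d []       = insertU-unique u h d []
  afterU-unique u h d (U ∷ w)  = superwords-unique u h d w
  afterU-unique u h d (D ∷ w)  = insertU-unique u h d (D ∷ w)
  afterU-unique u h d (H2 ∷ w) = insertU-unique u h d (H2 ∷ w)

  afterH-unique : ∀ u h d w → Unique (afterH u h d w)
  afterH-unique u h d []       = insertH-unique u h d []
  afterH-unique u h d (U ∷ w)  = insertH-unique u h d (U ∷ w)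
  afterH-unique u h d (D ∷ w)  = insertH-unique u h d (D ∷ w)
  afterH-unique u h d (H2 ∷ w) = superwords-unique u h d w

  afterD-unique : ∀ u h d w → Unique (afterD u h d w)
  afterD-unique u h d []       = insertD-unique u h d []
  afterD-unique u h d (U ∷ w)  = insertD-unique u h d (U ∷ w)
  afterD-unique u h d (D ∷ w)  = superwords-unique u h d w
  afterD-unique u h d (H2 ∷ w) = insertD-unique u h d (H2 ∷ w)

  insertU-unique : ∀ u h d w → Unique (insertU u h d w)
  insertU-unique zero    h d w = []
  insertU-unique (suc u) h d w = superwords-unique u h d w

  insertH-unique : ∀ u h d w → Unique (insertH u h d w)
  insertH-unique u zero    d w = []
  insertH-unique u (suc h) d w = superwords-unique u h d w

  insertD-unique : ∀ u h d w → Unique (insertD u h d w)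
  insertD-unique u h zero    w = []
  insertD-unique u h (suc d) w = superwords-unique u h d w

superwords-none : ∀ w → superwords 0 0 0 w ≡ [ w ]
superwords-none []       = refl
superwords-none (U ∷ w)  = cong (λ L → map (U ∷_) L ++ []) (superwords-none w)
superwords-none (D ∷ w)  = cong (map (D ∷_)) (superwords-none w)
superwords-none (H2 ∷ w) = cong (λ L → map (H2 ∷_) L ++ []) (superwords-none w)

-- Counting the superwords that stay above the x-axis

length-filter-map : ∀ {A B : Set} {p q} {P : Pred A p} {Q : Pred B q}
  (P? : Decidable P) (Q? : Decidable Q) (f : B → A) → (∀ x → does (P? (f x)) ≡ does (Q? x)) →
  ∀ xs → length (filter P? (map f xs)) ≡ length (filter Q? xs)
length-filter-map P? Q? f same [] = refl
length-filter-map P? Q? f same (x ∷ xs) with does (P? (f x)) | does (Q? x) | same x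
... | true  | true  | refl = cong suc (length-filter-map P? Q? f same xs)
... | false | false | refl = length-filter-map P? Q? f same xs

#SchröderFrom : ℕ → List (List Step) → ℕ
#SchröderFrom k L = length (filter (schröderFrom? k) L)

#SchröderFrom-++ : ∀ k L M → #SchröderFrom k (L ++ M) ≡ #SchröderFrom k L + #SchröderFrom k M
#SchröderFrom-++ k L M =
  trans (cong length (filter-++ (schröderFrom? k) L M)) (length-++ (filter (schröderFrom? k) L))

#SchröderFrom-map-U∷ : ∀ k L → #SchröderFrom k (map (U ∷_) L) ≡ #SchröderFrom (suc k) L
#SchröderFrom-map-U∷ k = length-filter-map (schröderFrom? k) (schröderFrom? (suc k)) (U ∷_) λ _ → refl

#SchröderFrom-map-H2∷ : ∀ k L → #SchröderFrom k (map (H2 ∷_) L) ≡ #SchröderFrom k L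
#SchröderFrom-map-H2∷ k = length-filter-map (schröderFrom? k) (schröderFrom? k) (H2 ∷_) λ _ → refl

#SchröderFrom-map-D∷ : ∀ k L → #SchröderFrom (suc k) (map (D ∷_) L) ≡ #SchröderFrom k L
#SchröderFrom-map-D∷ k = length-filter-map (schröderFrom? (suc k)) (schröderFrom? k) (D ∷_) λ _ → refl

#SchröderFrom-map-D∷-ground : ∀ L → #SchröderFrom 0 (map (D ∷_) L) ≡ 0
#SchröderFrom-map-D∷-ground []      = refl
#SchröderFrom-map-D∷-ground (_ ∷ L) = #SchröderFrom-map-D∷-ground L

#SchröderFrom-superwords : ∀ k u h d w → #SchröderFrom k (superwords u h d w) ≡
  #SchröderFrom k (ended u h d w) +
    (#SchröderFrom (suc k) (afterU u h d w) +
      (#SchröderFrom k (afterH u h d w) + #SchröderFrom k (map (D ∷_) (afterD u h d w))))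
#SchröderFrom-superwords k u h d w = begin
  #SchröderFrom k (ended u h d w ++ (U-block ++ (H-block ++ D-block)))
    ≡⟨ #SchröderFrom-++ k (ended u h d w) _ ⟩
  #SchröderFrom k (ended u h d w) + #SchröderFrom k (U-block ++ (H-block ++ D-block))
    ≡⟨ cong (#SchröderFrom k (ended u h d w) +_) (#SchröderFrom-++ k U-block _) ⟩
  #SchröderFrom k (ended u h d w) + (#SchröderFrom k U-block + #SchröderFrom k (H-block ++ D-block))
    ≡⟨ cong (λ n → #SchröderFrom k (ended u h d w) + (#SchröderFrom k U-block + n))
            (#SchröderFrom-++ k H-block D-block) ⟩
  #SchröderFrom k (ended u h d w) + (#SchröderFrom k U-block + (#SchröderFrom k H-block + #SchröderFrom k D-block))
    ≡⟨ cong₂ (λ m n → #SchröderFrom k (ended u h d w) + (m + (n + #SchröderFrom k D-block)))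
         (#SchröderFrom-map-U∷ k (afterU u h d w)) (#SchröderFrom-map-H2∷ k (afterH u h d w)) ⟩
  #SchröderFrom k (ended u h d w) +
  (#SchröderFrom (suc k) (afterU u h d w) + (#SchröderFrom k (afterH u h d w) + #SchröderFrom k D-block))
    ∎
  where
  U-block = map (U ∷_) (afterU u h d w)
  H-block = map (H2 ∷_) (afterH u h d w)
  D-block = map (D ∷_) (afterD u h d w)

#SchröderFrom-none : SchröderFrom k w → #SchröderFrom k (superwords 0 0 0 w) ≡ 1
#SchröderFrom-none {k} {w} s = begin
  #SchröderFrom k (superwords 0 0 0 w)  ≡⟨ cong (#SchröderFrom k) (superwords-none w) ⟩
  #SchröderFrom k [ w ]                 ≡⟨ cong length (filter-accept (schröderFrom? k) s) ⟩
  1                                     ∎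

#SchröderFrom-insertH : SchröderFrom k w → #SchröderFrom k (superwords 0 1 0 w) ≡ suc (#U w + #D w)
#SchröderFrom-insertH done = refl
#SchröderFrom-insertH {k} (up {w = w} s) = begin
    #SchröderFrom k (superwords 0 1 0 (U ∷ w))
  ≡⟨ #SchröderFrom-superwords k 0 1 0 (U ∷ w) ⟩
    #SchröderFrom (suc k) (superwords 0 1 0 w) + (#SchröderFrom k (superwords 0 0 0 (U ∷ w)) + 0)
  ≡⟨ cong₂ _+_ (#SchröderFrom-insertH s) (cong (_+ 0) (#SchröderFrom-none (up s))) ⟩
    suc (#U w + #D w) + 1
  ≡⟨ +-comm _ 1 ⟩
    suc (suc (#U w) + #D w)
  ∎
#SchröderFrom-insertH {suc k} (down {w = w} s) = begin
    #SchröderFrom (suc k) (superwords 0 1 0 (D ∷ w))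
  ≡⟨ #SchröderFrom-superwords (suc k) 0 1 0 (D ∷ w) ⟩
    #SchröderFrom (suc k) (superwords 0 0 0 (D ∷ w)) + #SchröderFrom (suc k) (map (D ∷_) (superwords 0 1 0 w))
  ≡⟨ cong₂ _+_ (#SchröderFrom-none (down s))
               (trans (#SchröderFrom-map-D∷ k (superwords 0 1 0 w)) (#SchröderFrom-insertH s)) ⟩
    1 + suc (#U w + #D w)
  ≡⟨ cong suc (sym (+-suc (#U w) (#D w))) ⟩
    suc (#U w + suc (#D w))
  ∎
#SchröderFrom-insertH {k} (hor {w = w} s) = begin
    #SchröderFrom k (superwords 0 1 0 (H2 ∷ w))
  ≡⟨ #SchröderFrom-superwords k 0 1 0 (H2 ∷ w) ⟩
    #SchröderFrom k (superwords 0 1 0 w) + 0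
  ≡⟨ +-identityʳ _ ⟩
    #SchröderFrom k (superwords 0 1 0 w)
  ≡⟨ #SchröderFrom-insertH s ⟩
    suc (#U w + #D w)
  ∎

#SchröderFrom-insertD : SchröderFrom k w → #SchröderFrom (suc k) (superwords 0 0 1 w) ≡ suc (semilength w)
#SchröderFrom-insertD done = refl
#SchröderFrom-insertD {k} (up {w = w} s) = begin
    #SchröderFrom (suc k) (superwords 0 0 1 (U ∷ w))
  ≡⟨ #SchröderFrom-superwords (suc k) 0 0 1 (U ∷ w) ⟩
    #SchröderFrom (suc (suc k)) (superwords 0 0 1 w) + #SchröderFrom (suc k) (map (D ∷_) (superwords 0 0 0 (U ∷ w)))
  ≡⟨ cong₂ _+_ (#SchröderFrom-insertD s)
               (trans (#SchröderFrom-map-D∷ k (superwords 0 0 0 (U ∷ w))) (#SchröderFrom-none (up s))) ⟩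
    suc (semilength w) + 1
  ≡⟨ +-comm _ 1 ⟩
    suc (suc (semilength w))
  ∎
#SchröderFrom-insertD {suc k} (down {w = w} s) = begin
    #SchröderFrom (suc (suc k)) (superwords 0 0 1 (D ∷ w))
  ≡⟨ #SchröderFrom-superwords (suc (suc k)) 0 0 1 (D ∷ w) ⟩
    #SchröderFrom (suc (suc k)) (map (D ∷_) (superwords 0 0 1 w))
  ≡⟨ #SchröderFrom-map-D∷ (suc k) (superwords 0 0 1 w) ⟩
    #SchröderFrom (suc k) (superwords 0 0 1 w)
  ≡⟨ #SchröderFrom-insertD s ⟩
    suc (semilength w)
  ∎
#SchröderFrom-insertD {k} (hor {w = w} s) = begin
    #SchröderFrom (suc k) (superwords 0 0 1 (H2 ∷ w))
  ≡⟨ #SchröderFrom-superwords (suc k) 0 0 1 (H2 ∷ w) ⟩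
    #SchröderFrom (suc k) (superwords 0 0 1 w) + #SchröderFrom (suc k) (map (D ∷_) (superwords 0 0 0 (H2 ∷ w)))
  ≡⟨ cong₂ _+_ (#SchröderFrom-insertD s)
               (trans (#SchröderFrom-map-D∷ k (superwords 0 0 0 (H2 ∷ w))) (#SchröderFrom-none (hor s))) ⟩
    suc (semilength w) + 1
  ≡⟨ +-comm _ 1 ⟩
    suc (suc (semilength w))
  ≡⟨ cong suc (sym (semilength-H2∷ w)) ⟩
    suc (semilength (H2 ∷ w))
  ∎

#SchröderFrom-insertU : FirstPassage (suc k) w → SchröderPath P →
  #SchröderFrom k (superwords 1 0 0 (w ++ P)) ≡ suc k + semilength w
#SchröderFrom-insertU {P = P} last p = begin
    #SchröderFrom 0 (superwords 1 0 0 (D ∷ P))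
  ≡⟨ #SchröderFrom-superwords 0 1 0 0 (D ∷ P) ⟩
    #SchröderFrom 1 (superwords 0 0 0 (D ∷ P)) + #SchröderFrom 0 (map (D ∷_) (superwords 1 0 0 P))
  ≡⟨ cong₂ _+_ (#SchröderFrom-none (down p)) (#SchröderFrom-map-D∷-ground (superwords 1 0 0 P)) ⟩
    1
  ∎
#SchröderFrom-insertU {k} {P = P} (up {w = w} f) p = begin
    #SchröderFrom k (superwords 1 0 0 (U ∷ w ++ P))
  ≡⟨ #SchröderFrom-superwords k 1 0 0 (U ∷ w ++ P) ⟩
    #SchröderFrom (suc k) (superwords 1 0 0 (w ++ P)) + 0
  ≡⟨ +-identityʳ _ ⟩
    #SchröderFrom (suc k) (superwords 1 0 0 (w ++ P))
  ≡⟨ #SchröderFrom-insertU f p ⟩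
    suc (suc k) + semilength w
  ≡⟨ sym (+-suc (suc k) (semilength w)) ⟩
    suc k + suc (semilength w)
  ∎
#SchröderFrom-insertU {suc k} {P = P} (down {w = w} f) p = begin
    #SchröderFrom (suc k) (superwords 1 0 0 (D ∷ w ++ P))
  ≡⟨ #SchröderFrom-superwords (suc k) 1 0 0 (D ∷ w ++ P) ⟩
    #SchröderFrom (suc (suc k)) (superwords 0 0 0 (D ∷ w ++ P))
      + #SchröderFrom (suc k) (map (D ∷_) (superwords 1 0 0 (w ++ P)))
  ≡⟨ cong₂ _+_ (#SchröderFrom-none (FirstPassage-++ (down f) p))
               (trans (#SchröderFrom-map-D∷ k (superwords 1 0 0 (w ++ P))) (#SchröderFrom-insertU f p)) ⟩
    1 + (suc k + semilength w)
  ∎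
#SchröderFrom-insertU {k} {P = P} (hor {w = w} f) p = begin
    #SchröderFrom k (superwords 1 0 0 (H2 ∷ w ++ P))
  ≡⟨ #SchröderFrom-superwords k 1 0 0 (H2 ∷ w ++ P) ⟩
    #SchröderFrom (suc k) (superwords 0 0 0 (H2 ∷ w ++ P)) + (#SchröderFrom k (superwords 1 0 0 (w ++ P)) + 0)
  ≡⟨ cong₂ _+_ (#SchröderFrom-none (FirstPassage-++ (hor f) p)) (cong (_+ 0) (#SchröderFrom-insertU f p)) ⟩
    1 + (suc k + semilength w + 0)
  ≡⟨ rearrange k (semilength w) ⟩
    suc k + suc (semilength w)
  ≡⟨ cong (suc k +_) (sym (semilength-H2∷ w)) ⟩
    suc k + semilength (H2 ∷ w)
  ∎
  where
  rearrange : ∀ k s → 1 + (suc k + s + 0) ≡ suc k + suc s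
  rearrange = solve-∀

#SchröderFrom-insertUD-passage : FirstPassage k w → SchröderPath P →
  #SchröderFrom k (superwords 1 0 1 (w ++ P)) ≡
  #SchröderFrom 0 (superwords 1 0 1 P) + (#H w + (k + semilength w) * suc (semilength w + semilength P))
#SchröderFrom-insertUD-passage {P = P} last p = begin
    #SchröderFrom 1 (superwords 1 0 1 (D ∷ P))
  ≡⟨ #SchröderFrom-superwords 1 1 0 1 (D ∷ P) ⟩
    #SchröderFrom 2 (superwords 0 0 1 (D ∷ P)) + #SchröderFrom 1 (map (D ∷_) (superwords 1 0 1 P))
  ≡⟨ cong₂ _+_ (#SchröderFrom-insertD (down p)) (#SchröderFrom-map-D∷ 0 (superwords 1 0 1 P)) ⟩
    suc t + N
  ≡⟨ rearrange t N ⟩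
    N + 1 * suc t
  ∎
  where
  t = semilength P
  N = #SchröderFrom 0 (superwords 1 0 1 P)
  rearrange : ∀ t n → suc t + n ≡ n + 1 * suc t
  rearrange = solve-∀
#SchröderFrom-insertUD-passage {suc k} {P = P} (up {w = w} f) p = begin
    #SchröderFrom (suc k) (superwords 1 0 1 (U ∷ w ++ P))
  ≡⟨ #SchröderFrom-superwords (suc k) 1 0 1 (U ∷ w ++ P) ⟩
    #SchröderFrom (suc (suc k)) (superwords 1 0 1 (w ++ P))
      + #SchröderFrom (suc k) (map (D ∷_) (superwords 1 0 0 (U ∷ w ++ P)))
  ≡⟨ cong₂ _+_ (#SchröderFrom-insertUD-passage f p)
               (trans (#SchröderFrom-map-D∷ k (superwords 1 0 0 (U ∷ w ++ P))) (#SchröderFrom-insertU (up f) p)) ⟩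
    N + (#H w + (suc (suc k) + s) * suc (s + t)) + (suc k + suc s)
  ≡⟨ rearrange N (#H w) k s t ⟩
    N + (#H w + (suc k + suc s) * suc (suc s + t))
  ∎
  where
  s = semilength w
  t = semilength P
  N = #SchröderFrom 0 (superwords 1 0 1 P)
  rearrange : ∀ n a k s t → n + (a + (suc (suc k) + s) * suc (s + t)) + (suc k + suc s)
                          ≡ n + (a + (suc k + suc s) * suc (suc s + t))
  rearrange = solve-∀
#SchröderFrom-insertUD-passage {suc (suc k)} {P = P} (down {w = w} f) p = begin
    #SchröderFrom (suc (suc k)) (superwords 1 0 1 (D ∷ w ++ P))
  ≡⟨ #SchröderFrom-superwords (suc (suc k)) 1 0 1 (D ∷ w ++ P) ⟩
    #SchröderFrom (suc (suc (suc k))) (superwords 0 0 1 (D ∷ w ++ P))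
      + #SchröderFrom (suc (suc k)) (map (D ∷_) (superwords 1 0 1 (w ++ P)))
  ≡⟨ cong₂ _+_ (trans (#SchröderFrom-insertD (FirstPassage-++ (down f) p)) (cong suc (semilength-++ w P)))
               (trans (#SchröderFrom-map-D∷ (suc k) (superwords 1 0 1 (w ++ P))) (#SchröderFrom-insertUD-passage f p)) ⟩
    suc (s + t) + (N + (#H w + (suc k + s) * suc (s + t)))
  ≡⟨ rearrange N (#H w) k s t ⟩
    N + (#H w + (suc (suc k) + s) * suc (s + t))
  ∎
  where
  s = semilength w
  t = semilength P
  N = #SchröderFrom 0 (superwords 1 0 1 P)
  rearrange : ∀ n a k s t → suc (s + t) + (n + (a + (suc k + s) * suc (s + t)))
                          ≡ n + (a + (suc (suc k) + s) * suc (s + t))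
  rearrange = solve-∀
#SchröderFrom-insertUD-passage {suc k} {P = P} (hor {w = w} f) p = begin
    #SchröderFrom (suc k) (superwords 1 0 1 (H2 ∷ w ++ P))
  ≡⟨ #SchröderFrom-superwords (suc k) 1 0 1 (H2 ∷ w ++ P) ⟩
    #SchröderFrom (suc (suc k)) (superwords 0 0 1 (H2 ∷ w ++ P))
      + (#SchröderFrom (suc k) (superwords 1 0 1 (w ++ P))
         + #SchröderFrom (suc k) (map (D ∷_) (superwords 1 0 0 (H2 ∷ w ++ P))))
  ≡⟨ cong₂ _+_ (trans (#SchröderFrom-insertD (FirstPassage-++ (hor f) p))
                      (cong suc (trans (semilength-H2∷ (w ++ P)) (cong suc (semilength-++ w P)))))
               (cong₂ _+_ (#SchröderFrom-insertUD-passage f p)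
                          (trans (#SchröderFrom-map-D∷ k (superwords 1 0 0 (H2 ∷ w ++ P)))
                                 (trans (#SchröderFrom-insertU (hor f) p) (cong (suc k +_) (semilength-H2∷ w))))) ⟩
    suc (suc (s + t)) + (N + (#H w + (suc k + s) * suc (s + t)) + (suc k + suc s))
  ≡⟨ rearrange N (#H w) k s t ⟩
    N + (suc (#H w) + (suc k + suc s) * suc (suc s + t))
  ≡⟨ cong (λ x → N + (suc (#H w) + (suc k + x) * suc (x + t))) (sym (semilength-H2∷ w)) ⟩
    N + (#H (H2 ∷ w) + (suc k + semilength (H2 ∷ w)) * suc (semilength (H2 ∷ w) + t))
  ∎
  where
  s = semilength w
  t = semilength P
  N = #SchröderFrom 0 (superwords 1 0 1 P)
  rearrange : ∀ n a k s t → suc (suc (s + t)) + (n + (a + (suc k + s) * suc (s + t)) + (suc k + suc s))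
                          ≡ n + (suc a + (suc k + suc s) * suc (suc s + t))
  rearrange = solve-∀

#SchröderFrom-insertUD : ∀ {Fs} → Factorisation P Fs →
  #SchröderFrom 0 (superwords 1 0 1 P) ≡ suc (#H P + pairSum (map semilength Fs))
#SchröderFrom-insertUD [] = refl
#SchröderFrom-insertUD (_∷_ {P = P} {Fs = Fs} hfac fs) = begin
    #SchröderFrom 0 (superwords 1 0 1 (H2 ∷ P))
  ≡⟨ #SchröderFrom-superwords 0 1 0 1 (H2 ∷ P) ⟩
    #SchröderFrom 1 (superwords 0 0 1 (H2 ∷ P))
      + (#SchröderFrom 0 (superwords 1 0 1 P) + #SchröderFrom 0 (map (D ∷_) (superwords 1 0 0 (H2 ∷ P))))
  ≡⟨ cong₂ _+_ (trans (#SchröderFrom-insertD (hor p)) (cong suc (semilength-H2∷ P)))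
               (cong₂ _+_ (#SchröderFrom-insertUD fs) (#SchröderFrom-map-D∷-ground (superwords 1 0 0 (H2 ∷ P)))) ⟩
    suc (suc t) + (suc (#H P + ps) + 0)
  ≡⟨ rearrange t (#H P) ps ⟩
    suc (suc (#H P) + (1 * (1 + t) + ps))
  ≡⟨ cong (λ x → suc (suc (#H P) + (1 * (1 + x) + ps))) (sym (sum-semilengths fs)) ⟩
    suc (#H (H2 ∷ P) + pairSum (semilength [ H2 ] ∷ map semilength Fs))
  ∎
  where
  p = Factorisation⇒SchröderPath fs
  t = semilength P
  ps = pairSum (map semilength Fs)
  rearrange : ∀ t a q → suc (suc t) + (suc (a + q) + 0) ≡ suc (suc a + (1 * (1 + t) + q))
  rearrange = solve-∀
#SchröderFrom-insertUD (_∷_ {P = P} {Fs = Fs} (ufac {R} r) fs) = begin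
    #SchröderFrom 0 (superwords 1 0 1 (U ∷ F ++ P))
  ≡⟨ #SchröderFrom-superwords 0 1 0 1 (U ∷ F ++ P) ⟩
    #SchröderFrom 1 (superwords 1 0 1 (F ++ P)) + #SchröderFrom 0 (map (D ∷_) (superwords 1 0 0 (U ∷ F ++ P)))
  ≡⟨ cong₂ _+_ (#SchröderFrom-insertUD-passage (SchröderFrom-∷ʳD r) (Factorisation⇒SchröderPath fs))
               (#SchröderFrom-map-D∷-ground (superwords 1 0 0 (U ∷ F ++ P))) ⟩
    #SchröderFrom 0 (superwords 1 0 1 P) + (#H F + (1 + s) * suc (s + t)) + 0
  ≡⟨ cong (λ n → n + (#H F + (1 + s) * suc (s + t)) + 0) (#SchröderFrom-insertUD fs) ⟩
    suc (#H P + ps) + (#H F + (1 + s) * suc (s + t)) + 0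
  ≡⟨ rearrange (#H F) (#H P) s t ps ⟩
    suc (#H F + #H P + (suc s * (suc s + t) + ps))
  ≡⟨ cong₂ (λ a x → suc (a + (suc s * (suc s + x) + ps))) (sym (#H-++ F P)) (sym (sum-semilengths fs)) ⟩
    suc (#H (F ++ P) + pairSum (semilength (U ∷ F) ∷ map semilength Fs))
  ∎
  where
  F = R ++ [ D ]
  s = semilength F
  t = semilength P
  ps = pairSum (map semilength Fs)
  rearrange : ∀ a b s t q → suc (b + q) + (a + (1 + s) * suc (s + t)) + 0 ≡ suc (a + b + (suc s * (suc s + t) + q))
  rearrange = solve-∀

-- Coverings

_⋖_ : List Step → List Step → Set
P ⋖ Q = SchröderPath Q × P ⊆ Q × semilength P + 1 ≡ semilength Q

m+n≡1-cases : ∀ m n → m + n ≡ 1 → (m ≡ 0 × n ≡ 1) ⊎ (m ≡ 1 × n ≡ 0)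
m+n≡1-cases 0      1       _  = inj₁ (refl , refl)
m+n≡1-cases 1      0       _  = inj₂ (refl , refl)
m+n≡1-cases 0      0       ()
m+n≡1-cases 0      (2+ _)  ()
m+n≡1-cases 1      (suc _) ()
m+n≡1-cases (2+ _) _       ()

⋖⇒Superword : SchröderPath P → P ⋖ Q → Superword 0 1 0 P Q ⊎ Superword 1 0 1 P Q
⋖⇒Superword {P} p (q , s , e) with x , y , sw ← Schröder-⊆⇒Superword p q s
  with m+n≡1-cases x y (sym (+-cancelˡ-≡ (semilength P) 1 (x + y) (trans e (Superword-semilength sw))))
... | inj₁ (refl , refl) = inj₁ sw
... | inj₂ (refl , refl) = inj₂ sw

coverers : List Step → List (List Step)
coverers P = filter (schröderFrom? 0) (superwords 0 1 0 P ++ superwords 1 0 1 P)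

coverers-unique : ∀ P → Unique (coverers P)
coverers-unique P = Unique.filter⁺ (schröderFrom? 0)
  (Unique.++⁺ (superwords-unique 0 1 0 P) (superwords-unique 1 0 1 P) distinct-#H)
  where
  distinct-#H : Disjoint (superwords 0 1 0 P) (superwords 1 0 1 P)
  distinct-#H (m₁ , m₂) =
    contradiction (+-cancelˡ-≡ (#H P) 1 0 (trans (sym (Superword.extraH sw₁)) (Superword.extraH sw₂))) λ ()
    where
    sw₁ = ∈-superwords⁻ {u = 0} {h = 1} {d = 0} {w = P} m₁
    sw₂ = ∈-superwords⁻ {u = 1} {h = 0} {d = 1} {w = P} m₂

∈-coverers : SchröderPath P → Q ∈ coverers P ⇔ P ⋖ Q
∈-coverers {P} {Q} p = mk⇔ to from
  where
  to : Q ∈ coverers P → P ⋖ Q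
  to m with m′ , q ← ∈-filter⁻ (schröderFrom? 0) m with ∈-++⁻ (superwords 0 1 0 P) m′
  ... | inj₁ m₁ with sw ← ∈-superwords⁻ {u = 0} {h = 1} {d = 0} {w = P} m₁ =
    q , Superword.sublist sw , sym (Superword-semilength sw)
  ... | inj₂ m₂ with sw ← ∈-superwords⁻ {u = 1} {h = 0} {d = 1} {w = P} m₂ =
    q , Superword.sublist sw , sym (Superword-semilength sw)
  from : P ⋖ Q → Q ∈ coverers P
  from c@(q , _) with ⋖⇒Superword p c
  ... | inj₁ sw = ∈-filter⁺ (schröderFrom? 0) (∈-++⁺ˡ (∈-superwords⁺ sw)) q
  ... | inj₂ sw = ∈-filter⁺ (schröderFrom? 0) (∈-++⁺ʳ (superwords 0 1 0 P) (∈-superwords⁺ sw)) q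

length-coverers : ∀ {Fs} → SchröderPath P → Factorisation P Fs →
  length (coverers P) ≡ 2 + length P + pairSum (map semilength Fs)
length-coverers {P} {Fs} p fs = begin
    #SchröderFrom 0 (superwords 0 1 0 P ++ superwords 1 0 1 P)
  ≡⟨ #SchröderFrom-++ 0 (superwords 0 1 0 P) (superwords 1 0 1 P) ⟩
    #SchröderFrom 0 (superwords 0 1 0 P) + #SchröderFrom 0 (superwords 1 0 1 P)
  ≡⟨ cong₂ _+_ (#SchröderFrom-insertH p) (#SchröderFrom-insertUD fs) ⟩
    suc (#U P + #D P) + suc (#H P + ps)
  ≡⟨ rearrange (#U P) (#D P) (#H P) ps ⟩
    2 + (#U P + #D P + #H P) + ps
  ≡⟨ cong (λ n → 2 + n + ps) (sym (length≡#U+#D+#H P)) ⟩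
    2 + length P + ps
  ∎
  where
  ps = pairSum (map semilength Fs)
  rearrange : ∀ a b c q → suc (a + b) + suc (c + q) ≡ 2 + (a + b + c) + q
  rearrange = solve-∀

mainTheorem2 : (P : List Step) (Fs : List (List Step)) →
    SchröderPath P → Factorisation P Fs →
    Σ (List (List Step)) λ Qs →
      Unique Qs ×
      ((Q : List Step) → Q ∈ Qs ⇔ (SchröderPath Q × P ⊆ Q × semilength P + 1 ≡ semilength Q)) ×
      length Qs ≡ 2 + length P + pairSum (map (λ F → #U F + #H F) Fs)
mainTheorem2 P Fs p fs = coverers P , coverers-unique P , (λ _ → ∈-coverers p) , length-coverers p fs
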